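{- For all integers $r\geq 2$ and $d\geq 1$, $Z(r,d)=\gamma_t(K_r^{\times d})=\tau(H(r,d))$.
   Context: Good partition: given a coloring of the edges of a complete bipartite graph with parts $Y,Z$ using colors from $[r]$, a partition $\{Y_1,\dots,Y_k\}$ of $Y$ ($1\le k\le r$, parts allowed empty) is good if for every $z\in Z$ there are $i\in[k]$ and $y\in Y_i$ with $zy$ of color $i$. $Z(r,d)$ is the smallest positive integer $z$ such that for the complete bipartite graph with parts of sizes $|Y|=d$, $|Z|=z$ there is an $[r]$-coloring of its edges with no good partition of $Y$. $K_r^{\times d}$ is the graph with vertex set $[r]^d$ in which $(a_1,\dots,a_d)$ and $(b_1,\dots,b_d)$ are adjacent iff $a_i\neq b_i$ for all $i\in[d]$. A total dominating set of a graph is a vertex set $S$ such that every vertex has a neighbor in $S$; $\gamma_t$ is the minimum size of a total dominating set. $H(r,d)$ is the hypergraph on vertex set $[r]^d$ whose edges are the neighborhoods $N(v)$ in $K_r^{\times d}$, $v\in[r]^d$. $\tau$ denotes the minimum size of a vertex cover (a vertex set meeting every edge). -}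

module Defs where

open import Data.Nat using (ℕ; _≤_; _<_)
open import Data.Fin using (Fin; toℕ)
open import Data.List using (List; length)
open import Data.List.Membership.Propositional using (_∈_)
open import Data.List.Relation.Unary.Unique.Propositional using (Unique)
open import Data.Product using (Σ; _×_; ∃; ∃-syntax)
open import Relation.Binary.PropositionalEquality using (_≡_; _≢_)

IsLeast : (ℕ → Set) → ℕ → Set
IsLeast P n = P n × (∀ m → P m → n ≤ m)

-- An [r]-colouring of the edges of K_{d,z}: colour of the edge (y , z).
-- Colours 1..r are represented by Fin r (colour i+1 ↔ element i).
Colouring : ℕ → ℕ → ℕ → Set
Colouring r d z = Fin d → Fin z → Fin r

-- A partition {Y_1,…,Y_k} of Y = Fin d into k (possibly empty) labelled parts,
-- given by the map sending y to the index of its part.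
Partition : ℕ → ℕ → Set
Partition d k = Fin d → Fin k

Good : ∀ {r d z k} → Colouring r d z → Partition d k → Set
Good {z = z} c p = ∀ (w : Fin z) → ∃[ y ] (toℕ (p y) ≡ toℕ (c y w))

HasGoodPartition : ∀ {r d z} → Colouring r d z → Set
HasGoodPartition {r} {d} c =
  ∃[ k ] (1 ≤ k × k ≤ r × Σ (Partition d k) (λ p → Good c p))

ZProp : ℕ → ℕ → ℕ → Set
ZProp r d z = 1 ≤ z × Σ (Colouring r d z) (λ c → HasGoodPartition c → Data.Empty.⊥)
  where import Data.Empty

IsZ : ℕ → ℕ → ℕ → Set
IsZ r d = IsLeast (ZProp r d)

Vertex : ℕ → ℕ → Set
Vertex r d = Fin d → Fin r

Adj : ∀ {r d} → Vertex r d → Vertex r d → Set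
Adj {d = d} a b = ∀ (i : Fin d) → a i ≢ b i

record VSet (r d : ℕ) : Set where
  constructor vset
  field
    elems  : List (Vertex r d)
    unique : Unique elems
open VSet public

size : ∀ {r d} → VSet r d → ℕ
size S = length (elems S)

IsTotalDominating : ∀ {r d} → VSet r d → Set
IsTotalDominating {r} {d} S = ∀ (v : Vertex r d) → ∃[ u ] (u ∈ elems S × Adj v u)

IsGammaT : ℕ → ℕ → ℕ → Set
IsGammaT r d = IsLeast (λ n → Σ (VSet r d) (λ S → IsTotalDominating S × size S ≡ n))

-- The hypergraph H(r,d): vertex set [r]^d, edges N(v) for v ∈ [r]^d

InNbhd : ∀ {r d} → Vertex r d → Vertex r d → Set
InNbhd v u = Adj v u

IsVertexCover : ∀ {r d} → VSet r d → Set
IsVertexCover {r} {d} C = ∀ (v : Vertex r d) → ∃[ u ] (u ∈ elems C × InNbhd v u)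

IsTau : ℕ → ℕ → ℕ → Set
IsTau r d = IsLeast (λ n → Σ (VSet r d) (λ C → IsVertexCover C × size C ≡ n))

-- A colouring of K_{d,z} is the same as a family of z columns, each a vertex of
-- K_r^{×d}, and a partition of Y into at most r parts is (up to injecting the
-- labels) also a vertex v of K_r^{×d}.  Such a partition is good exactly when v
-- agrees with every column in some coordinate, i.e. when v has no neighbour
-- among the columns.  Hence a colouring has no good partition iff its columns
-- totally dominate K_r^{×d}, so Z(r,d) is the least size of a totally dominating
-- family of vertices; removing repeated columns turns a least such family into a
-- totally dominating set of the same size.  A total dominating set of K_r^{×d}
-- and a vertex cover of H(r,d) are literally the same thing.
module Submission where

open import Defs
open import Data.Nat using (ℕ; _≤_; zero; suc; _^_; z≤n; s≤s)
open import Data.Nat.Properties using (≤-refl; ≤-antisym; ≮⇒≥; m≤n⇒m≤1+n)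
open import Data.Fin using (Fin; toℕ; fromℕ; fromℕ<; inject≤; finToFun; funToFin)
  renaming (zero to fzero; suc to fsuc)
open import Data.Fin.Properties
  using (_≟_; any?; all?; ¬∀⟶∃¬; ¬∀⟶∃¬-smallest; toℕ-fromℕ; toℕ-fromℕ<; toℕ-inject;
         toℕ-inject≤; toℕ-injective; finToFun-funToFin)
open import Data.List using (List; []; _∷_; length; lookup; tabulate)
open import Data.List.Properties using (length-tabulate)
open import Data.List.Membership.Propositional using (_∈_; find)
open import Data.List.Membership.Propositional.Properties using (∈-tabulate⁺)
open import Data.List.Relation.Unary.Any as Any using (here; there)
open import Data.List.Relation.Unary.Any.Properties using (lookup-index)
import Data.List.Relation.Unary.All as All
open import Data.List.Relation.Unary.AllPairs using ([]; _∷_)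
open import Data.List.Relation.Unary.Unique.Propositional using (Unique)
open import Data.Product using (∃-syntax; _×_; Σ; ∃; _,_; proj₁; proj₂)
open import Data.Vec.Functional using (Vector)
open import Data.Empty using (⊥-elim)
open import Function using (_∘_; flip)
open import Relation.Nullary using (Dec; yes; no; ¬_)
open import Relation.Nullary.Decidable using (¬?; map′; decidable-stable)
open import Relation.Binary.PropositionalEquality
  using (_≡_; _≢_; _≗_; refl; sym; trans; cong; subst)

leastWitness : (P : ℕ → Set) → (∀ n → Dec (P n)) → ∀ {N} → P N → ∃ (IsLeast P)
leastWitness P P? {N} pN
  with ¬∀⟶∃¬-smallest (suc N) (¬_ ∘ P ∘ toℕ) (¬? ∘ P? ∘ toℕ)
         (λ none → none (fromℕ N) (subst P (sym (toℕ-fromℕ N)) pN))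
... | i , ¬¬Pi , below = toℕ i , decidable-stable (P? (toℕ i)) ¬¬Pi , minimal
  where
  minimal : ∀ m → P m → toℕ i ≤ m
  minimal m pm = ≮⇒≥ λ m<i →
    below (fromℕ< m<i) (subst P (sym (trans (toℕ-inject _) (toℕ-fromℕ< m<i))) pm)

isLeast-transfer : {P Q : ℕ → Set} {n : ℕ} →
  IsLeast P n → Q n → (∀ m → Q m → P m) → IsLeast Q n
isLeast-transfer (_ , least) qn Q⇒P = qn , λ m → least m ∘ Q⇒P m

-- Quantifiers over Fin n → Fin m are decided through the coding Fin (m ^ n).
module _ {m n} {P : (Fin n → Fin m) → Set}
         (resp : ∀ {f g} → f ≗ g → P f → P g) (P? : ∀ f → Dec (P f)) where

  allFunctions? : Dec (∀ f → P f)
  allFunctions? = map′ (λ all f → resp (finToFun-funToFin f) (all (funToFin f)))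
                       (λ all → all ∘ finToFun)
                       (all? (P? ∘ finToFun))

  anyFunction? : Dec (∃ P)
  anyFunction? = map′ (λ (k , p) → finToFun k , p)
                      (λ (f , p) → funToFin f , resp (sym ∘ finToFun-funToFin f) p)
                      (any? (P? ∘ finToFun))

module _ {A : Set} {_≈_ : A → A → Set} (≈-refl : ∀ {x} → x ≈ x)
         (_≈?_ : ∀ x y → Dec (x ≈ y)) where

  deduplicateUpTo : (xs : List A) → Σ (List A) λ ys → Unique ys × length ys ≤ length xs ×
                      (∀ {x} → x ∈ xs → ∃[ y ] (y ∈ ys × x ≈ y))
  deduplicateUpTo [] = [] , [] , z≤n , λ ()
  deduplicateUpTo (x ∷ xs) with deduplicateUpTo xs
  ... | ys , ys-unique , shorter , covered with Any.any? (x ≈?_) ys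
  ... | yes x≈some = ys , ys-unique , m≤n⇒m≤1+n shorter , λ where
    (here refl) → find x≈some
    (there x∈xs) → covered x∈xs
  ... | no x≉all = x ∷ ys , All.tabulate x≢ys ∷ ys-unique , s≤s shorter , coverage
    where
    x≢ys : ∀ {y} → y ∈ ys → x ≢ y
    x≢ys y∈ys x≡y = x≉all (Any.map (λ y≡ → subst (x ≈_) (trans x≡y y≡) ≈-refl) y∈ys)

    coverage : ∀ {x′} → x′ ∈ x ∷ xs → ∃[ y ] (y ∈ x ∷ ys × x′ ≈ y)
    coverage (here refl) = x , here refl , ≈-refl
    coverage (there x′∈xs) = let y , y∈ys , x′≈y = covered x′∈xs in y , there y∈ys , x′≈y

adjacent? : ∀ {r d} (v u : Vertex r d) → Dec (Adj v u)
adjacent? v u = all? λ i → ¬? (v i ≟ u i)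

adj-respˡ : ∀ {r d} {v v′ u : Vertex r d} → v ≗ v′ → Adj v u → Adj v′ u
adj-respˡ v≗v′ adj i v′≡u = adj i (trans (v≗v′ i) v′≡u)

adj-respʳ : ∀ {r d} {v u u′ : Vertex r d} → u ≗ u′ → Adj v u → Adj v u′
adj-respʳ u≗u′ adj i v≡u′ = adj i (trans v≡u′ (sym (u≗u′ i)))

¬adj⇒agree : ∀ {r d} {v u : Vertex r d} → ¬ Adj v u → ∃[ y ] v y ≡ u y
¬adj⇒agree {d = d} {v} {u} ¬adj
  with ¬∀⟶∃¬ d (λ y → v y ≢ u y) (λ y → ¬? (v y ≟ u y)) ¬adj
... | y , ¬≢ = y , decidable-stable (v y ≟ u y) ¬≢

Dominates : ∀ {r d z} → Vector (Vertex r d) z → Set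
Dominates {r} {d} cols = ∀ (v : Vertex r d) → ∃[ w ] Adj v (cols w)

HasDominatingFamily : ℕ → ℕ → ℕ → Set
HasDominatingFamily r d z = Σ (Vector (Vertex r d) z) Dominates

hasDominatingFamily? : ∀ r d z → Dec (HasDominatingFamily r d z)
hasDominatingFamily? r d z =
  map′ (λ (codes , dom) → columns codes , dom)
       (λ (cols , dom) → funToFin ∘ cols , recode cols dom)
       (anyFunction? resp dominates?)
  where
  columns : Vector (Fin (r ^ d)) z → Vector (Vertex r d) z
  columns codes = finToFun ∘ codes

  recode : ∀ cols → Dominates cols → Dominates (columns (funToFin ∘ cols))
  recode cols dom v = let w , adj = dom v in
    w , adj-respʳ (sym ∘ finToFun-funToFin (cols w)) adj

  resp : ∀ {codes codes′} → codes ≗ codes′ →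
         Dominates (columns codes) → Dominates (columns codes′)
  resp codes≗ dom v = let w , adj = dom v in
    w , subst (Adj v ∘ finToFun) (codes≗ w) adj

  dominates? : ∀ codes → Dec (Dominates (columns codes))
  dominates? codes = allFunctions?
    (λ v≗v′ (w , adj) → w , adj-respˡ v≗v′ adj)
    (λ v → any? (adjacent? v ∘ columns codes))

dominates⇒positive : ∀ {r d z} {cols : Vector (Vertex (suc r) d) z} →
  Dominates cols → 1 ≤ z
dominates⇒positive {z = zero} dom with dom (λ _ → fzero)
... | () , _
dominates⇒positive {z = suc _} _ = s≤s z≤n

-- finToFun lists every vertex; v is adjacent to the vertex changing every coordinate of v.
allVertices-dominate : ∀ r d → Dominates {suc (suc r)} {d} finToFun
allVertices-dominate r d v =
  funToFin (other ∘ v) , adj-respʳ (sym ∘ finToFun-funToFin _) (other-≢ ∘ v)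
  where
  other : Fin (suc (suc r)) → Fin (suc (suc r))
  other fzero = fsuc fzero
  other (fsuc _) = fzero

  other-≢ : ∀ a → a ≢ other a
  other-≢ fzero ()
  other-≢ (fsuc _) ()

dominates⇒noGoodPartition : ∀ {r d z} {c : Colouring r d z} →
  Dominates (flip c) → ¬ HasGoodPartition c
dominates⇒noGoodPartition dom (k , _ , k≤r , p , good)
  with dom (λ y → inject≤ (p y) k≤r)
... | w , adj with good w
... | y , same = adj y (toℕ-injective (trans (toℕ-inject≤ (p y) k≤r) same))

noGoodPartition⇒dominates : ∀ {r d z} {c : Colouring (suc r) d z} →
  ¬ HasGoodPartition c → Dominates (flip c)
noGoodPartition⇒dominates {r} {c = c} noGood v with any? (adjacent? v ∘ flip c)
... | yes found = found
... | no none = ⊥-elim (noGood (suc r , s≤s z≤n , ≤-refl , v , good))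
  where
  good : Good c v
  good w = let y , agree = ¬adj⇒agree (λ adj → none (w , adj)) in y , cong toℕ agree

DominatingList : ∀ {r d} → List (Vertex r d) → Set
DominatingList {r} {d} L = ∀ (v : Vertex r d) → ∃[ u ] (u ∈ L × Adj v u)

dominatingList⇒dominates : ∀ {r d} {L : List (Vertex r d)} →
  DominatingList L → Dominates (lookup L)
dominatingList⇒dominates dom v = let _ , u∈L , adj = dom v in
  Any.index u∈L , subst (Adj v) (lookup-index u∈L) adj

dominates⇒smallDominatingSet : ∀ {r d z} {cols : Vector (Vertex r d) z} → Dominates cols →
  Σ (VSet r d) λ S → DominatingList (elems S) × size S ≤ z
dominates⇒smallDominatingSet {cols = cols} dom
  with deduplicateUpTo (λ _ → refl) (λ u u′ → all? λ i → u i ≟ u′ i) (tabulate cols)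
... | ys , ys-unique , shorter , covered =
  vset ys ys-unique , dominating , subst (length ys ≤_) (length-tabulate cols) shorter
  where
  dominating : DominatingList ys
  dominating v = let w , adj = dom v
                     u , u∈ys , col≗u = covered (∈-tabulate⁺ w)
                 in u , u∈ys , adj-respʳ col≗u adj

theorem6p15 : ∀ (r d : ℕ) → 2 ≤ r → 1 ≤ d →
    ∃[ n ] (IsZ r d n × IsGammaT r d n × IsTau r d n)
theorem6p15 (suc (suc r)) d (s≤s (s≤s z≤n)) _ = n , isZ , isGammaT , isGammaT
  where
  R = suc (suc r)
  least = leastWitness (HasDominatingFamily R d) (hasDominatingFamily? R d)
                       (finToFun , allVertices-dominate r d)
  n = proj₁ least
  isLeast = proj₂ least
  family = proj₁ (proj₁ isLeast)
  dominates = proj₂ (proj₁ isLeast)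

  isZ : IsZ R d n
  isZ = isLeast-transfer isLeast
    (dominates⇒positive dominates , flip family , dominates⇒noGoodPartition dominates)
    (λ _ (_ , c , noGood) → flip c , noGoodPartition⇒dominates noGood)

  isGammaT : IsGammaT R d n
  isGammaT = isLeast-transfer isLeast
    (let S , dom , small = dominates⇒smallDominatingSet dominates
     in S , dom , ≤-antisym small (proj₂ isLeast _ (_ , dominatingList⇒dominates dom)))
    (λ { _ (S , dom , refl) → _ , dominatingList⇒dominates dom })
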